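{- Let $(\mathcal{A},\mathcal{T})$ be an ALF instance with $\mathcal{A} = (\mathcal{C}, \mathcal{H}, (\mathcal{S},\sqsubseteq_\mathrm{s},\sqcup,\bot_\mathrm{s}), \gamma, \kappa)$ such that $\mathcal{T}$ is realizable, let $\lambda$ be a consistent learner and let $\tau$ be a teacher for $(\mathcal{A},\mathcal{T})$. If $\mathcal{S}$ is a complete sample lattice, then for all ordinals $\alpha$: (a) either $\kappa(S_{\tau,\lambda}^\alpha) \supsetneq \kappa(S_{\tau,\lambda}^{\alpha+1})$ and $\gamma(\lambda(S_{\tau,\lambda}^\alpha)) \notin \kappa(S_{\tau,\lambda}^{\alpha+1})$, or $\gamma(\lambda(S_{\tau,\lambda}^\alpha)) \in \mathcal{T}$; and (b) $\mathcal{T} \subseteq \kappa(S_{\tau,\lambda}^\alpha)$. If $\mathcal{S}$ is not a complete sample lattice, then (a) and (b) hold for all natural numbers $\alpha \in \mathbb{N}$.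
   Context: An abstract learning framework (ALF) is a tuple $\mathcal{A} = (\mathcal{C}, \mathcal{H}, (\mathcal{S},\sqsubseteq_\mathrm{s},\sqcup,\bot_\mathrm{s}), \gamma, \kappa)$ where $\mathcal{C}$ (concept space) and $\mathcal{H}$ (hypothesis space) are classes, $(\mathcal{S},\sqsubseteq_\mathrm{s},\sqcup,\bot_\mathrm{s})$ (sample space) is a join semi-lattice with binary least upper bound $\sqcup$ and least element $\bot_\mathrm{s}$, $\gamma:\mathcal{H}\to\mathcal{C}$ is a function, and $\kappa:\mathcal{S}\to 2^{\mathcal{C}}$ satisfies $\kappa(\bot_\mathrm{s})=\mathcal{C}$ and $\kappa(S_1\sqcup S_2)=\kappa(S_1)\cap\kappa(S_2)$ for all $S_1,S_2\in\mathcal{S}$. The sample space is complete if the join $\bigsqcup \mathcal{S}'$ exists for every subset $\mathcal{S}'\subseteq\mathcal{S}$; in that case $\kappa$ is additionally required to satisfy $\kappa(\bigsqcup\mathcal{S}')=\bigcap_{S\in\mathcal{S}'}\kappa(S)$. Let $\kappa_\mathcal{H}(S)=\{H\in\mathcal{H}\mid \gamma(H)\in\kappa(S)\}$; a sample $S$ is realizable if $\kappa_\mathcal{H}(S)\neq\emptyset$. An ALF instance is a pair $(\mathcal{A},\mathcal{T})$ with $\mathcal{T}\subseteq\mathcal{C}$; $\mathcal{T}$ is realizable if $\gamma(H)\in\mathcal{T}$ for some $H\in\mathcal{H}$. A learner is a map $\lambda:\mathcal{S}\to\mathcal{H}$; it is consistent if $\gamma(\lambda(S))\in\kappa(S)$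 for every realizable $S$. A teacher for $(\mathcal{A},\mathcal{T})$ is a map $\tau:\mathcal{H}\to\mathcal{S}$ such that (progress) $\tau(H)=\bot_\mathrm{s}$ whenever $\gamma(H)\in\mathcal{T}$, and $\gamma(H)\notin\kappa(\tau(H))$ whenever $\gamma(H)\notin\mathcal{T}$; and (honesty) $\mathcal{T}\subseteq\kappa(\tau(H))$ for every $H\in\mathcal{H}$. For a learner $\lambda$ and teacher $\tau$, define $f_{\tau,\lambda}(S)=S\sqcup\tau(\lambda(S))$ and the sequence $S_{\tau,\lambda}^0=\bot_\mathrm{s}$, $S_{\tau,\lambda}^{\alpha+1}=f_{\tau,\lambda}(S_{\tau,\lambda}^\alpha)$, and, for limit ordinals $\alpha$ (only when the sample space is complete), $S_{\tau,\lambda}^\alpha=\bigsqcup_{\beta<\alpha}S_{\tau,\lambda}^\beta$. If the sample space is not complete, the sequence is defined only for natural-number indices by the first two clauses. -}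

module Defs where

open import Level using (0ℓ)
open import Data.Nat using (ℕ; zero; suc)
open import Data.Product using (Σ; ∃; _×_; _,_)
open import Data.Sum using (_⊎_)
open import Relation.Nullary using (¬_)
open import Relation.Unary using (Pred; U; _⊆_; _⊃_; _≐_; _∩_; _∈_; _∉_)
open import Relation.Binary.PropositionalEquality using (_≡_)
open import Relation.Binary.Structures using (IsStrictTotalOrder)
open import Relation.Binary.Lattice.Structures using (IsBoundedJoinSemilattice)
open import Induction.WellFounded using (WellFounded)

record ALF : Set₁ where
  field
    C   : Set
    H   : Set
    S   : Set
    _⊑_ : S → S → Set
    _⊔_ : S → S → S
    ⊥s  : S
    isBJSL : IsBoundedJoinSemilattice _≡_ _⊑_ _⊔_ ⊥s
    γ   : H → C
    κ   : S → Pred C 0ℓ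
    κ-⊥ : κ ⊥s ≐ U
    κ-⊔ : ∀ S₁ S₂ → κ (S₁ ⊔ S₂) ≐ (κ S₁ ∩ κ S₂)

  κH : S → Pred H 0ℓ
  κH X h = γ h ∈ κ X

  Realizable : S → Set
  Realizable X = ∃ λ h → h ∈ κH X

record Complete (A : ALF) : Set₁ where
  open ALF A
  field
    ⨆       : Pred S 0ℓ → S
    ⨆-upper : ∀ (P : Pred S 0ℓ) X → X ∈ P → X ⊑ ⨆ P
    ⨆-least : ∀ (P : Pred S 0ℓ) Y → (∀ X → X ∈ P → X ⊑ Y) → ⨆ P ⊑ Y
    κ-⨆     : ∀ (P : Pred S 0ℓ) → κ (⨆ P) ≐ (λ c → ∀ X → X ∈ P → c ∈ κ X)

module _ (A : ALF) where
  open ALF A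

  TRealizable : Pred C 0ℓ → Set
  TRealizable T = ∃ λ h → γ h ∈ T

  Consistent : (S → H) → Set
  Consistent λ′ = ∀ X → Realizable X → γ (λ′ X) ∈ κ X

  record Teacher (T : Pred C 0ℓ) (τ : H → S) : Set where
    field
      progress-in  : ∀ h → γ h ∈ T → τ h ≡ ⊥s
      progress-out : ∀ h → γ h ∉ T → γ h ∉ κ (τ h)
      honesty      : ∀ h → T ⊆ κ (τ h)

  step : (H → S) → (S → H) → S → S
  step τ λ′ X = X ⊔ τ (λ′ X)

  iter : (H → S) → (S → H) → ℕ → S
  iter τ λ′ zero    = ⊥s
  iter τ λ′ (suc n) = step τ λ′ (iter τ λ′ n)

  -- Transfinite sequence: an ordinal is represented as an element of a
  -- well-order (W, <) (strict total, well-founded).  s : W → S is the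
  -- sequence S^α_{τ,λ} iff it satisfies the defining clauses at zero,
  -- successor and limit positions.
  record IsIterSeq (cmp : Complete A) (τ : H → S) (λ′ : S → H)
                   {W : Set} (_<_ : W → W → Set) (s : W → S) : Set where
    open Complete cmp
    field
      at-zero  : ∀ α → (∀ β → ¬ (β < α)) → s α ≡ ⊥s
      at-succ  : ∀ α β → β < α → (∀ δ → δ < α → (δ < β) ⊎ (δ ≡ β))
                 → s α ≡ step τ λ′ (s β)
      at-limit : ∀ α → (∃ λ β → β < α)
                 → (∀ β → β < α → ∃ λ δ → (β < δ) × (δ < α))
                 → s α ≡ ⨆ (λ X → ∃ λ β → (β < α) × (s β ≡ X))

  -- Property (a) for a sample X = S^α (so S^{α+1} = step X).
  PropA : Pred C 0ℓ → (H → S) → (S → H) → S → Set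
  PropA T τ λ′ X =
    ((κ X ⊃ κ (step τ λ′ X)) × (γ (λ′ X) ∉ κ (step τ λ′ X)))
    ⊎ (γ (λ′ X) ∈ T)

  PropB : Pred C 0ℓ → S → Set
  PropB T X = T ⊆ κ X

module Submission where

-- Property (b), "T ⊆ κ(S)", is an invariant of the learning
-- iteration: it holds for ⊥ (κ ⊥ = C), is preserved by a step S ↦ S ⊔ τ(λ S)
-- because the teacher is honest, and is preserved by arbitrary joins because
-- κ turns joins into intersections.  Property (a) at a sample S follows from
-- (b) at S alone: if γ(λ S) ∉ T, then S is realizable (T is realizable and
-- T ⊆ κ S), so by consistency γ(λ S) ∈ κ S, while by progress
-- γ(λ S) ∉ κ(τ(λ S)) ⊇ κ(S ⊔ τ(λ S)); hence the inclusion is strict.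

open import Defs
open import Level using (0ℓ)
open import Data.Nat using (ℕ; zero; suc)
open import Data.Product using (_×_; _,_; proj₁; proj₂; ∃)
open import Data.Sum using (_⊎_; inj₁; inj₂)
open import Data.Empty using (⊥-elim)
open import Relation.Nullary using (yes; no; ¬_)
open import Relation.Unary using (Pred; _⊆_; _∈_; _∉_)
open import Relation.Binary.PropositionalEquality using (_≡_; subst; sym)
open import Relation.Binary.Structures using (IsStrictTotalOrder)
open import Relation.Binary.Definitions using (tri<; tri≈; tri>)
open import Induction.WellFounded using (WellFounded; module All)
open import Axiom.ExcludedMiddle using (ExcludedMiddle)

-- These are exactly the cases of IsIterSeq.
module Positions {W : Set} (_<_ : W → W → Set) where

  IsZero : W → Set
  IsZero α = ∀ β → ¬ (β < α)

  IsSuccessorOf : W → W → Set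
  IsSuccessorOf α β = (β < α) × (∀ δ → δ < α → (δ < β) ⊎ (δ ≡ β))

  IsLimit : W → Set
  IsLimit α = (∃ λ β → β < α) × (∀ β → β < α → ∃ λ δ → (β < δ) × (δ < α))

  data Position (α : W) : Set where
    zero-pos  : IsZero α → Position α
    succ-pos  : ∀ β → IsSuccessorOf α β → Position α
    limit-pos : IsLimit α → Position α

  -- A predecessor β with nothing strictly between β and α
  -- is, by trichotomy, the greatest predecessor.
  classify : ExcludedMiddle 0ℓ → IsStrictTotalOrder _≡_ _<_ → ∀ α → Position α
  classify em sto α with em {∃ λ β → β < α}
  ... | no none = zero-pos (λ β β<α → none (β , β<α))
  ... | yes some with em {∃ λ β → IsSuccessorOf α β}
  ...   | yes (β , succ) = succ-pos β succ
  ...   | no noSucc = limit-pos (some , between)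
    where
      open IsStrictTotalOrder sto using (compare)

      between : ∀ β → β < α → ∃ λ δ → (β < δ) × (δ < α)
      between β β<α with em {∃ λ δ → (β < δ) × (δ < α)}
      ... | yes found = found
      ... | no nothing = ⊥-elim (noSucc (β , β<α , greatest))
        where
          greatest : ∀ δ → δ < α → (δ < β) ⊎ (δ ≡ β)
          greatest δ δ<α with compare δ β
          ... | tri< δ<β _ _ = inj₁ δ<β
          ... | tri≈ _ δ≡β _ = inj₂ δ≡β
          ... | tri> _ _ β<δ = ⊥-elim (nothing (δ , β<δ , δ<α))

module Framework (A : ALF) where
  open ALF A

  ⊆-κ-⊔ : ∀ {P : Pred C 0ℓ} S₁ S₂ → P ⊆ κ S₁ → P ⊆ κ S₂ → P ⊆ κ (S₁ ⊔ S₂)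
  ⊆-κ-⊔ S₁ S₂ P⊆κ₁ P⊆κ₂ c∈P = proj₂ (κ-⊔ S₁ S₂) (P⊆κ₁ c∈P , P⊆κ₂ c∈P)

  κ-⊔-⊆ˡ : ∀ S₁ S₂ → κ (S₁ ⊔ S₂) ⊆ κ S₁
  κ-⊔-⊆ˡ S₁ S₂ c∈κ = proj₁ (proj₁ (κ-⊔ S₁ S₂) c∈κ)

  κ-⊔-⊆ʳ : ∀ S₁ S₂ → κ (S₁ ⊔ S₂) ⊆ κ S₂
  κ-⊔-⊆ʳ S₁ S₂ c∈κ = proj₂ (proj₁ (κ-⊔ S₁ S₂) c∈κ)

  ⊆-κ-⨆ : (cmp : Complete A) → ∀ {P : Pred C 0ℓ} (Q : Pred S 0ℓ)
          → (∀ X → X ∈ Q → P ⊆ κ X) → P ⊆ κ (Complete.⨆ cmp Q)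
  ⊆-κ-⨆ cmp Q P⊆κ c∈P = proj₂ (Complete.κ-⨆ cmp Q) (λ X X∈Q → P⊆κ X X∈Q c∈P)

  iterSeq-induction : ExcludedMiddle 0ℓ → (cmp : Complete A)
    → (τ : H → S) (λ′ : S → H) {W : Set} (_<_ : W → W → Set)
    → IsStrictTotalOrder _≡_ _<_ → WellFounded _<_
    → (s : W → S) → IsIterSeq A cmp τ λ′ _<_ s
    → (P : Pred S 0ℓ) → P ⊥s → (∀ X → P X → P (step A τ λ′ X))
    → (∀ Q → (∀ X → X ∈ Q → P X) → P (Complete.⨆ cmp Q))
    → ∀ α → P (s α)
  iterSeq-induction em cmp τ λ′ _<_ sto wf s isq P P⊥ Pstep P⨆ =
    All.wfRec wf 0ℓ (λ α → P (s α)) atPosition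
    where
      open Positions _<_
      open IsIterSeq isq

      atPosition : ∀ α → (∀ {β} → β < α → P (s β)) → P (s α)
      atPosition α ih with classify em sto α
      ... | zero-pos z = subst P (sym (at-zero α z)) P⊥
      ... | succ-pos β (β<α , greatest) =
        subst P (sym (at-succ α β β<α greatest)) (Pstep (s β) (ih β<α))
      ... | limit-pos (some , between) =
        subst P (sym (at-limit α some between))
          (P⨆ _ (λ X (β , β<α , sβ≡X) → subst P sβ≡X (ih β<α)))

module Invariants (A : ALF) (T : Pred (ALF.C A) 0ℓ) (TR : TRealizable A T)
  (λ′ : ALF.S A → ALF.H A) (consistent : Consistent A λ′)
  (τ : ALF.H A → ALF.S A) (teacher : Teacher A T τ) where
  open ALF A
  open Framework A
  open Teacher teacher

  B-⊥ : PropB A T ⊥s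
  B-⊥ _ = proj₂ κ-⊥ _

  B-step : ∀ X → PropB A T X → PropB A T (step A τ λ′ X)
  B-step X T⊆κX = ⊆-κ-⊔ X (τ (λ′ X)) T⊆κX (honesty (λ′ X))

  B-⨆ : (cmp : Complete A) → ∀ Q → (∀ X → X ∈ Q → PropB A T X)
        → PropB A T (Complete.⨆ cmp Q)
  B-⨆ cmp = ⊆-κ-⨆ cmp

  -- (a) follows from (b): either the hypothesis is correct, or it was
  -- consistent with X but is ruled out by the teacher's counterexample.
  A-from-B : ExcludedMiddle 0ℓ → ∀ X → PropB A T X → PropA A T τ λ′ X
  A-from-B em X T⊆κX with em {γ (λ′ X) ∈ T}
  ... | yes correct = inj₂ correct
  ... | no incorrect = inj₁ ((κ-⊔-⊆ˡ X (τ h) , strict) , refuted)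
    where
      h : H
      h = λ′ X

      realizable : Realizable X
      realizable = proj₁ TR , T⊆κX (proj₂ TR)

      refuted : γ h ∉ κ (step A τ λ′ X)
      refuted γh∈ = progress-out h incorrect (κ-⊔-⊆ʳ X (τ h) γh∈)

      strict : ¬ (κ X ⊆ κ (step A τ λ′ X))
      strict κX⊆ = refuted (κX⊆ (consistent X realizable))

  B-iter : ∀ n → PropB A T (iter A τ λ′ n)
  B-iter zero    = B-⊥
  B-iter (suc n) = B-step _ (B-iter n)

lemma1 : ExcludedMiddle 0ℓ
    → (A : ALF) (T : Pred (ALF.C A) 0ℓ) → TRealizable A T
    → (λ′ : ALF.S A → ALF.H A) → Consistent A λ′
    → (τ : ALF.H A → ALF.S A) → Teacher A T τ
    → ((n : ℕ) → PropA A T τ λ′ (iter A τ λ′ n) × PropB A T (iter A τ λ′ n))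
      × ((cmp : Complete A) {W : Set} (_<_ : W → W → Set)
         → IsStrictTotalOrder _≡_ _<_ → WellFounded _<_
         → (s : W → ALF.S A) → IsIterSeq A cmp τ λ′ _<_ s
         → (α : W) → PropA A T τ λ′ (s α) × PropB A T (s α))
lemma1 em A T TR λ′ consistent τ teacher = finite , transfinite
  where
    open Invariants A T TR λ′ consistent τ teacher
    open Framework A using (iterSeq-induction)

    finite : ∀ n → PropA A T τ λ′ (iter A τ λ′ n) × PropB A T (iter A τ λ′ n)
    finite n = A-from-B em _ (B-iter n) , B-iter n

    transfinite : (cmp : Complete A) {W : Set} (_<_ : W → W → Set)
      → IsStrictTotalOrder _≡_ _<_ → WellFounded _<_
      → (s : W → ALF.S A) → IsIterSeq A cmp τ λ′ _<_ s
      → (α : W) → PropA A T τ λ′ (s α) × PropB A T (s α)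
    transfinite cmp _<_ sto wf s isq α = A-from-B em (s α) Bα , Bα
      where
        Bα : PropB A T (s α)
        Bα = iterSeq-induction em cmp τ λ′ _<_ sto wf s isq (PropB A T)
               B-⊥ B-step (B-⨆ cmp) α
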